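{- Let $k$ be a positive integer, let $G$ be a graph, and let $L$ be a $k$-list-assignment of $G$ such that $G$ is $L$-critical with respect to $L$. Then for every induced subgraph $H$ of $G$ with at least one vertex, $\delta(H) < \Delta(G) - k + \chi_\ell(H)$.
   Context: A list assignment $L$ of $G$ assigns to each vertex $v$ a nonempty set $L(v)$ of colours; it is a $k$-list-assignment if $|L(v)|\ge k$ for all $v$. An $L$-colouring is a proper colouring $\phi$ with $\phi(v)\in L(v)$. $G$ is $L$-critical if $G$ has no $L$-colouring but every proper subgraph of $G$ has one. $\delta(H)$ is the minimum degree of $H$, $\Delta(G)$ the maximum degree of $G$, and $\chi_\ell(H)$ the list chromatic number of $H$. -}

module Defs where

open import Data.Nat using (ℕ; zero; suc; _+_; _<_; _≤_; _⊔_; _⊓_)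
open import Data.Fin using (Fin)
open import Data.Fin.Subset using (Subset; _∈_; Nonempty)
open import Data.Fin.Subset.Properties using (_∈?_)
open import Data.List using (List; []; _∷_; length; filter; map; foldr; allFin)
open import Data.List.Relation.Unary.Unique.Propositional using (Unique)
import Data.List.Membership.Propositional as LM
open import Data.Product using (Σ; _×_; _,_)
open import Relation.Nullary using (¬_; Dec)
open import Relation.Nullary.Decidable using (_×-dec_)
open import Relation.Binary.PropositionalEquality using (_≡_; _≢_)

record Graph (n : ℕ) : Set₁ where
  field
    Adj     : Fin n → Fin n → Set
    adj?    : ∀ u v → Dec (Adj u v)
    sym     : ∀ {u v} → Adj u v → Adj v u
    irrefl  : ∀ {v} → ¬ Adj v v
open Graph public

ListAssignment : ℕ → Set
ListAssignment n = Fin n → List ℕ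

IsKListAssignment : ∀ {n} → ℕ → ListAssignment n → Set
IsKListAssignment k L = ∀ v → Unique (L v) × k ≤ length (L v)

IsLColouring : ∀ {n} → Graph n → ListAssignment n → (Fin n → ℕ) → Set
IsLColouring G L φ = (∀ v → φ v LM.∈ L v) × (∀ u v → Adj G u v → φ u ≢ φ v)

LColourable : ∀ {n} → Graph n → ListAssignment n → Set
LColourable {n} G L = Σ (Fin n → ℕ) λ φ → IsLColouring G L φ

record Subgraph {n : ℕ} (G : Graph n) : Set₁ where
  field
    V'      : Subset n
    E'      : Fin n → Fin n → Set
    E'-sym  : ∀ {u v} → E' u v → E' v u
    E'⊆E    : ∀ {u v} → E' u v → Adj G u v × u ∈ V' × v ∈ V'
open Subgraph public

IsProper : ∀ {n} {G : Graph n} → Subgraph G → Set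
IsProper {n} {G} H = ¬ ((∀ v → v ∈ V' H) × (∀ u v → Adj G u v → E' H u v))

SubgraphLColourable : ∀ {n} {G : Graph n} → Subgraph G → ListAssignment n → Set
SubgraphLColourable {n} H L =
  Σ (Fin n → ℕ) λ φ → (∀ v → v ∈ V' H → φ v LM.∈ L v) × (∀ u v → E' H u v → φ u ≢ φ v)

IsLCritical : ∀ {n} → Graph n → ListAssignment n → Set₁
IsLCritical G L = ¬ LColourable G L × (∀ (H : Subgraph G) → IsProper H → SubgraphLColourable H L)

degreeIn : ∀ {n} → Graph n → Subset n → Fin n → ℕ
degreeIn G S v = length (filter (λ u → (u ∈? S) ×-dec adj? G v u) (allFin _))

degree : ∀ {n} → Graph n → Fin n → ℕ
degree G v = length (filter (λ u → adj? G v u) (allFin _))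

-- Maximum degree Δ(G) (0 for the empty graph).
maxDegree : ∀ {n} → Graph n → ℕ
maxDegree G = foldr _⊔_ 0 (map (degree G) (allFin _))

minList : List ℕ → ℕ
minList []       = 0
minList (x ∷ xs) = foldr _⊓_ x xs

-- Minimum degree δ(G[S]) of the induced subgraph G[S] (meaningful for nonempty S).
minDegreeInduced : ∀ {n} → Graph n → Subset n → ℕ
minDegreeInduced G S = minList (map (degreeIn G S) (filter (λ v → v ∈? S) (allFin _)))

InducedChoosable : ∀ {n} → Graph n → Subset n → ℕ → Set
InducedChoosable {n} G S m =
  ∀ (L' : ListAssignment n) →
    (∀ v → v ∈ S → Unique (L' v) × m ≤ length (L' v)) →
    Σ (Fin n → ℕ) λ φ → (∀ v → v ∈ S → φ v LM.∈ L' v)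
                      × (∀ u v → u ∈ S → v ∈ S → Adj G u v → φ u ≢ φ v)

IsListChromaticNumber : ∀ {n} → Graph n → Subset n → ℕ → Set
IsListChromaticNumber G S m = InducedChoosable G S m × (∀ j → j < m → ¬ InducedChoosable G S j)

module Submission where

-- Suppose instead Δ(G) + χ_ℓ(H) ≤ δ(H) + k.  Since S is nonempty, G − S is a
-- proper subgraph of G, so by criticality it has an L-colouring φ.  For v ∈ S let
-- L'(v) be L(v) with the φ-colours of the neighbours of v outside S deleted.  At most
-- deg(v) − deg_H(v) ≤ Δ(G) − δ(H) colours are deleted, so |L'(v)| ≥ k − Δ(G) + δ(H)
-- ≥ χ_ℓ(H), and H has an L'-colouring φ'.  Gluing φ' on S with φ off S gives an
-- L-colouring of G, contradicting criticality.

open import Defs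
open import Data.Bool using (if_then_else_)
open import Data.Nat using (ℕ; suc; _+_; _<_; _≤_; _⊔_; _⊓_; z≤n; s≤s; _≟_; _<?_)
open import Data.Nat.Properties
open import Data.Fin using (Fin)
open import Data.Fin.Subset using (Subset; Nonempty; ∁) renaming (_∈_ to _∈ₛ_)
open import Data.Fin.Subset.Properties using (_∈?_; x∈∁p⇒x∉p; x∉p⇒x∈∁p)
open import Data.List using (List; []; _∷_; length; filter; map; foldr; allFin)
open import Data.List.Relation.Unary.Unique.Propositional using (Unique; _∷_)
import Data.List.Relation.Unary.Unique.Propositional.Properties as Unique
open import Data.List.Relation.Unary.All using () renaming (map to All-map)
open import Data.List.Relation.Unary.Any using (here; there)
open import Data.List.Membership.Propositional using (_∈_; _∉_)
open import Data.List.Membership.Propositional.Properties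
  using (∈-map⁺; ∈-filter⁺; ∈-filter⁻; ∈-allFin)
open import Data.List.Properties using (filter-all; length-map)
open import Data.Empty using (⊥-elim)
open import Data.Product using (_×_; _,_; proj₁; proj₂)
open import Relation.Nullary using (¬_; Dec; yes; no; does; ¬?)
open import Relation.Nullary.Decidable using (_×-dec_)
open import Relation.Binary.Definitions using (DecidableEquality)
open import Relation.Binary.PropositionalEquality using (_≢_; refl; cong; subst) renaming (sym to ≡-sym)

module Deletion {A : Set} (_≟ₐ_ : DecidableEquality A) where

  delete : A → List A → List A
  delete y = filter (λ c → ¬? (c ≟ₐ y))

  _∖_ : List A → List A → List A
  xs ∖ []       = xs
  xs ∖ (y ∷ ys) = delete y (xs ∖ ys)

  length-delete : ∀ y xs → Unique xs → length xs ≤ suc (length (delete y xs))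
  length-delete y []       _          = z≤n
  length-delete y (x ∷ xs) (x∉xs ∷ u) with x ≟ₐ y
  ... | yes refl
    rewrite filter-all (λ c → ¬? (c ≟ₐ x)) (All-map (λ x≢c c≡x → x≢c (≡-sym c≡x)) x∉xs)
    = ≤-refl
  ... | no _ = s≤s (length-delete y xs u)

  ∖-unique : ∀ xs ys → Unique xs → Unique (xs ∖ ys)
  ∖-unique xs []       u = u
  ∖-unique xs (y ∷ ys) u = Unique.filter⁺ (λ c → ¬? (c ≟ₐ y)) (∖-unique xs ys u)

  length-∖ : ∀ xs ys → Unique xs → length xs ≤ length (xs ∖ ys) + length ys
  length-∖ xs []       u = ≤-reflexive (≡-sym (+-identityʳ (length xs)))
  length-∖ xs (y ∷ ys) u = begin
    length xs                                ≤⟨ length-∖ xs ys u ⟩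
    length (xs ∖ ys) + length ys              ≤⟨ +-monoˡ-≤ (length ys)
                                                   (length-delete y (xs ∖ ys) (∖-unique xs ys u)) ⟩
    suc (length (xs ∖ (y ∷ ys))) + length ys ≡⟨ ≡-sym (+-suc _ (length ys)) ⟩
    length (xs ∖ (y ∷ ys)) + length (y ∷ ys) ∎
    where open ≤-Reasoning

  ∖-⊆ : ∀ xs ys {c} → c ∈ xs ∖ ys → c ∈ xs
  ∖-⊆ xs []       c∈ = c∈
  ∖-⊆ xs (y ∷ ys) c∈ = ∖-⊆ xs ys (proj₁ (∈-filter⁻ (λ c → ¬? (c ≟ₐ y)) {xs = xs ∖ ys} c∈))

  ∖-disjoint : ∀ xs ys {c} → c ∈ xs ∖ ys → c ∉ ys
  ∖-disjoint xs (y ∷ ys) c∈ (here refl) = proj₂ (∈-filter⁻ (λ c → ¬? (c ≟ₐ y)) {xs = xs ∖ ys} c∈) refl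
  ∖-disjoint xs (y ∷ ys) c∈ (there c∈ys) =
    ∖-disjoint xs ys (proj₁ (∈-filter⁻ (λ c → ¬? (c ≟ₐ y)) {xs = xs ∖ ys} c∈)) c∈ys

open Deletion _≟_ using (_∖_; ∖-unique; length-∖; ∖-⊆; ∖-disjoint)

foldr-⊔-upper : ∀ xs {x} → x ∈ xs → x ≤ foldr _⊔_ 0 xs
foldr-⊔-upper (y ∷ ys) (here refl) = m≤m⊔n y _
foldr-⊔-upper (y ∷ ys) (there x∈) = ≤-trans (foldr-⊔-upper ys x∈) (m≤n⊔m y _)

foldr-⊓-lower : ∀ y ys {x} → x ∈ y ∷ ys → foldr _⊓_ y ys ≤ x
foldr-⊓-lower y []       (here refl) = ≤-refl
foldr-⊓-lower y (z ∷ zs) (here refl) = ≤-trans (m⊓n≤n z _) (foldr-⊓-lower y zs (here refl))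
foldr-⊓-lower y (z ∷ zs) (there (here refl)) = m⊓n≤m z _
foldr-⊓-lower y (z ∷ zs) (there (there x∈)) =
  ≤-trans (m⊓n≤n z _) (foldr-⊓-lower y zs (there x∈))

minList-lower : ∀ xs {x} → x ∈ xs → minList xs ≤ x
minList-lower (y ∷ ys) = foldr-⊓-lower y ys

degree≤maxDegree : ∀ {n} (G : Graph n) v → degree G v ≤ maxDegree G
degree≤maxDegree G v = foldr-⊔-upper _ (∈-map⁺ (degree G) (∈-allFin v))

minDegreeInduced≤degreeIn : ∀ {n} (G : Graph n) S {v} → v ∈ₛ S →
                            minDegreeInduced G S ≤ degreeIn G S v
minDegreeInduced≤degreeIn G S v∈S =
  minList-lower _ (∈-map⁺ (degreeIn G S) (∈-filter⁺ (_∈? S) (∈-allFin _) v∈S))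

-- Splitting a degree into neighbours inside and outside S: filtering P by Q and by ¬Q
-- counts each P-element at most once.
length-filter-split : ∀ {A : Set} {P Q : A → Set} (P? : ∀ x → Dec (P x)) (Q? : ∀ x → Dec (Q x))
  xs → length (filter (λ x → Q? x ×-dec P? x) xs) + length (filter (λ x → ¬? (Q? x) ×-dec P? x) xs)
       ≤ length (filter P? xs)
length-filter-split P? Q? []       = z≤n
length-filter-split P? Q? (x ∷ xs) with Q? x | P? x
... | yes _ | yes _ = s≤s (length-filter-split P? Q? xs)
... | yes _ | no  _ = length-filter-split P? Q? xs
... | no  _ | yes _ = ≤-trans (≤-reflexive (+-suc _ _)) (s≤s (length-filter-split P? Q? xs))
... | no  _ | no  _ = length-filter-split P? Q? xs

outerNeighbours : ∀ {n} → Graph n → Subset n → Fin n → List (Fin n)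
outerNeighbours {n} G S v = filter (λ u → ¬? (u ∈? S) ×-dec adj? G v u) (allFin n)

outerNeighbour : ∀ {n} (G : Graph n) S {u v} → ¬ u ∈ₛ S → Adj G v u → u ∈ outerNeighbours G S v
outerNeighbour G S u∉S vu = ∈-filter⁺ (λ u → ¬? (u ∈? S) ×-dec adj? G _ u) (∈-allFin _) (u∉S , vu)

degreeIn+outer≤maxDegree : ∀ {n} (G : Graph n) S v →
  degreeIn G S v + length (outerNeighbours G S v) ≤ maxDegree G
degreeIn+outer≤maxDegree {n} G S v =
  ≤-trans (length-filter-split (adj? G v) (_∈? S) (allFin n)) (degree≤maxDegree G v)

deleteVertices : ∀ {n} (G : Graph n) → Subset n → Subgraph G
deleteVertices G S = record
  { V'     = ∁ S
  ; E'     = λ u v → Adj G u v × u ∈ₛ ∁ S × v ∈ₛ ∁ S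
  ; E'-sym = λ { (uv , u∉S , v∉S) → Graph.sym G uv , v∉S , u∉S }
  ; E'⊆E   = λ e → e
  }

deleteVertices-proper : ∀ {n} (G : Graph n) S → Nonempty S → IsProper (deleteVertices G S)
deleteVertices-proper G S (w , w∈S) (allVertices , _) = x∈∁p⇒x∉p (allVertices w) w∈S

residualLists : ∀ {n} → Graph n → Subset n → ListAssignment n → (Fin n → ℕ) → ListAssignment n
residualLists G S L φ v = L v ∖ map φ (outerNeighbours G S v)

length-residual : ∀ {n} (G : Graph n) S L φ v → Unique (L v) →
  length (L v) ≤ length (residualLists G S L φ v) + length (outerNeighbours G S v)
length-residual G S L φ v u = begin
  length (L v)                                         ≤⟨ length-∖ (L v) outerColours u ⟩
  length (residualLists G S L φ v) + length outerColours
    ≡⟨ cong (length (residualLists G S L φ v) +_) (length-map φ (outerNeighbours G S v)) ⟩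
  length (residualLists G S L φ v) + length (outerNeighbours G S v) ∎
  where
  open ≤-Reasoning
  outerColours = map φ (outerNeighbours G S v)

residual-size : ∀ {n} (G : Graph n) S L φ k m → IsKListAssignment k L →
  maxDegree G + m ≤ minDegreeInduced G S + k →
  ∀ v → v ∈ₛ S → Unique (residualLists G S L φ v) × m ≤ length (residualLists G S L φ v)
residual-size G S L φ k m isK Δ+m≤δ+k v v∈S =
  ∖-unique (L v) (map φ (outerNeighbours G S v)) (proj₁ (isK v)) , +-cancelʳ-≤ (maxDegree G) m r bound
  where
  open ≤-Reasoning
  r = length (residualLists G S L φ v)
  d = degreeIn G S v
  o = length (outerNeighbours G S v)
  bound : m + maxDegree G ≤ r + maxDegree G
  bound = begin
    m + maxDegree G            ≡⟨ +-comm m _ ⟩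
    maxDegree G + m            ≤⟨ Δ+m≤δ+k ⟩
    minDegreeInduced G S + k   ≤⟨ +-mono-≤ (minDegreeInduced≤degreeIn G S v∈S)
                                    (≤-trans (proj₂ (isK v)) (length-residual G S L φ v (proj₁ (isK v)))) ⟩
    d + (r + o)                ≡⟨ +-comm d (r + o) ⟩
    (r + o) + d                ≡⟨ +-assoc r o d ⟩
    r + (o + d)                ≡⟨ cong (r +_) (+-comm o d) ⟩
    r + (d + o)                ≤⟨ +-monoʳ-≤ r (degreeIn+outer≤maxDegree G S v) ⟩
    r + maxDegree G            ∎

glue : ∀ {n} (G : Graph n) S L (φ φ' : Fin n → ℕ) →
  (∀ v → v ∈ₛ ∁ S → φ v ∈ L v) →
  (∀ u v → E' (deleteVertices G S) u v → φ u ≢ φ v) →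
  (∀ v → v ∈ₛ S → φ' v ∈ residualLists G S L φ v) →
  (∀ u v → u ∈ₛ S → v ∈ₛ S → Adj G u v → φ' u ≢ φ' v) →
  LColourable G L
glue {n} G S L φ φ' φ∈L φ-proper φ'∈L' φ'-proper = ψ , (λ v → ψ∈L v (v ∈? S)) , ψ-proper
  where
  combine : ∀ {v} → Dec (v ∈ₛ S) → ℕ
  combine {v} v∈?S = if does v∈?S then φ' v else φ v

  ψ : Fin n → ℕ
  ψ v = combine (v ∈? S)

  ψ∈L : ∀ v (v∈?S : Dec (v ∈ₛ S)) → combine v∈?S ∈ L v
  ψ∈L v (yes v∈S) = ∖-⊆ (L v) (map φ (outerNeighbours G S v)) (φ'∈L' v v∈S)
  ψ∈L v (no  v∉S) = φ∈L v (x∉p⇒x∈∁p v∉S)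

  -- Across the cut the colours differ because φ'(u) avoids the colours of u's outer neighbours.
  across : ∀ u v → u ∈ₛ S → ¬ v ∈ₛ S → Adj G u v → φ' u ≢ φ v
  across u v u∈S v∉S uv φ'u≡φv = ∖-disjoint (L u) _ (φ'∈L' u u∈S)
    (subst (_∈ map φ (outerNeighbours G S u)) (≡-sym φ'u≡φv)
           (∈-map⁺ φ (outerNeighbour G S v∉S uv)))

  combine-proper : ∀ u v (u∈?S : Dec (u ∈ₛ S)) (v∈?S : Dec (v ∈ₛ S)) → Adj G u v →
                   combine u∈?S ≢ combine v∈?S
  combine-proper u v (yes u∈S) (yes v∈S) uv = φ'-proper u v u∈S v∈S uv
  combine-proper u v (yes u∈S) (no  v∉S) uv = across u v u∈S v∉S uv
  combine-proper u v (no  u∉S) (yes v∈S) uv = λ eq → across v u v∈S u∉S (Graph.sym G uv) (≡-sym eq)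
  combine-proper u v (no  u∉S) (no  v∉S) uv =
    φ-proper u v (uv , x∉p⇒x∈∁p u∉S , x∉p⇒x∈∁p v∉S)

  ψ-proper : ∀ u v → Adj G u v → ψ u ≢ ψ v
  ψ-proper u v = combine-proper u v (u ∈? S) (v ∈? S)

proposition2p1 : ∀ (k : ℕ) → 1 ≤ k → ∀ {n} (G : Graph n) (L : ListAssignment n) →
    IsKListAssignment k L → IsLCritical G L →
    ∀ (S : Subset n) → Nonempty S → ∀ (χ : ℕ) → IsListChromaticNumber G S χ →
    minDegreeInduced G S + k < maxDegree G + χ
proposition2p1 k _ G L isK (notColourable , criticalSub) S nonempty χ (χ-choosable , _)
  with minDegreeInduced G S + k <? maxDegree G + χ
... | yes δ+k<Δ+χ = δ+k<Δ+χ
... | no  δ+k≮Δ+χ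
  with criticalSub (deleteVertices G S) (deleteVertices-proper G S nonempty)
... | φ , φ∈L , φ-proper
  with χ-choosable (residualLists G S L φ) (residual-size G S L φ k χ isK (≮⇒≥ δ+k≮Δ+χ))
... | φ' , φ'∈L' , φ'-proper =
  ⊥-elim (notColourable (glue G S L φ φ' φ∈L φ-proper φ'∈L' φ'-proper))
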